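{- Let $G$ be a graph with $n=|V(G)|$, $S\subseteq V(G)$, $M>1$, $t\in\mathbb N\cup\{0\}$, $d\geq0$ and $\delta>0$. Suppose there is a set $A\subseteq V(G)$ with $|A|=m\geq\delta n\geq1$ such that $|W^S_t(v;M)|\leq n/m$ and $d^S_G(v)\geq d$ for all $v\in A$. Then there is $U\subseteq A$ with $|U|\geq\delta m/2$ such that $|N^S_G(u)\triangle N^S_G(v)|\geq4^td/M$ for all distinct $u,v\in U$.
   Context: $N^S_G(u)=N_G(u)\cap S$, $d^S_G(u)=|N^S_G(u)|$. For $M>1$ and $t\in\mathbb N\cup\{0\}$, the $(M,t)$-cluster neighbourhood of $v$ to $S$ is $W^S_t(v;M)=\{u\in V(G):|N^S_G(u)\triangle N^S_G(v)|\leq(4^t/M)\cdot|N^S_G(v)|\}$.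
   Formalization: The parameters M, d and δ take rational values. -}

module Defs where

open import Data.Bool using (Bool; true; false)
open import Data.Nat as ℕ using (ℕ; _^_)
open import Data.Fin using (Fin)
open import Data.Fin.Subset using (Subset; _∩_; _∪_; _─_; ∣_∣)
open import Data.Vec using (tabulate)
open import Data.Integer using (+_)
open import Data.Rational using (ℚ; _/_; _≤_; _÷_; _*_; NonZero)
open import Data.Rational.Properties using (_≤?_)
open import Relation.Nullary.Decidable using (does)
open import Relation.Binary.PropositionalEquality using (_≡_)

record Graph (n : ℕ) : Set where
  field
    Adj   : Fin n → Fin n → Bool
    sym   : ∀ u v → Adj u v ≡ Adj v u
    irrefl : ∀ v → Adj v v ≡ false
open Graph public

ℕ→ℚ : ℕ → ℚ
ℕ→ℚ k = (+ k) / 1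

2ℚ : ℚ
2ℚ = (+ 2) / 1

N : ∀ {n} → Graph n → Fin n → Subset n
N G u = tabulate (λ w → Adj G u w)

NS : ∀ {n} → Graph n → Subset n → Fin n → Subset n
NS G S u = N G u ∩ S

dS : ∀ {n} → Graph n → Subset n → Fin n → ℕ
dS G S u = ∣ NS G S u ∣

_△_ : ∀ {n} → Subset n → Subset n → Subset n
X △ Y = (X ─ Y) ∪ (Y ─ X)

W : ∀ {n} → Graph n → Subset n → (t : ℕ) → (M : ℚ) → .{{_ : NonZero M}} → Fin n → Subset n
W G S t M v = tabulate (λ u →
  does (ℕ→ℚ ∣ NS G S u △ NS G S v ∣ ≤? ((ℕ→ℚ (4 ^ t) ÷ M) * ℕ→ℚ (dS G S v))))

-- Greedily choose a maximal subset U of A whose members are pairwise at distance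
-- |N^S(u) △ N^S(v)| ≥ 4^t d / M.  By maximality every a ∈ A is closer than that to
-- some u ∈ U, and as d ≤ d^S(u) this puts a into W^S_t(u;M).  So A is covered by |U|
-- cluster neighbourhoods, each of size at most n/|A|, whence |U| ≥ |A|²/n ≥ δ|A|.

{-# OPTIONS --safe #-}
module Submission where

open import Algebra.Bundles using (CommutativeRing)
open import Data.Empty using (⊥-elim)
open import Data.Fin.Base using (Fin; zero; suc)
open import Data.Fin.Properties using (any?; _≟_)
open import Data.Fin.Subset using (Subset; _∈_; _⊆_; ∣_∣; ⊥; ⁅_⁆; _∪_; _─_; inside; outside)
open import Data.Fin.Subset.Properties
  using (_∈?_; ∉⊥; ∣⊥∣≡0; ∣p∣≤n; ∣p∣≤∣x∷p∣; p⊆q⇒∣p∣≤∣q∣; p⊆p∪q; q⊆p∪q; x∈p∪q⁻; x∈⁅x⁆; x∈⁅y⁆⇒x≡y; ∪-comm)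
open import Data.Integer.Base as ℤ using (+_)
import Data.Integer.Properties as ℤ
open import Data.List.Base using (List; allFin) renaming ([] to []ₗ; _∷_ to _∷ₗ_)
open import Data.List.Membership.Propositional using () renaming (_∈_ to _∈ₗ_)
open import Data.List.Membership.Propositional.Properties using (∈-allFin)
open import Data.List.Relation.Unary.Any using () renaming (here to hereₗ; there to thereₗ)
open import Data.Nat.Base as ℕ using (ℕ; suc; _^_)
import Data.Nat.Properties as ℕ
import Data.Nat.DivMod as ℕ
open import Data.Nat.Coprimality using (1-coprimeTo) renaming (sym to coprime-sym)
open import Data.Product.Base using (Σ; ∃-syntax; _×_; _,_)
open import Data.Rational.Base
  using (ℚ; 0ℚ; 1ℚ; mkℚ; _/_; _<_; _≤_; _÷_; _*_; 1/_; *≤*; NonZero; NonNegative; Positive; positive)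
open import Data.Rational.Properties
  using (normalize-coprime; normalize-nonNeg; normalize-pos; toℚᵘ-mono-≤; toℚᵘ-fromℚᵘ;
         ≤-trans; <-trans; <⇒≤; ≮⇒≥; <-≤-trans; _≤?_; _<?_; *-identityʳ;
         *-monoˡ-≤-nonNeg; *-monoʳ-≤-nonNeg; *-cancelʳ-≤-pos; nonNeg*nonNeg⇒nonNeg;
         pos⇒nonNeg; pos⇒nonZero; 1/pos⇒pos; nonNegative⁻¹; positive⁻¹; +-*-commutativeRing; module ≤-Reasoning)
import Data.Rational.Unnormalised.Base as ℚᵘ
import Data.Rational.Unnormalised.Properties as ℚᵘ
open import Data.Sum.Base using (_⊎_; inj₁; inj₂)
open import Data.Vec.Base using ([]; _∷_; here; there)
open import Data.Vec.Properties using (lookup∘tabulate; lookup⇒[]=)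
open import Function.Base using (_∘_)
open import Level using (Level; 0ℓ)
open import Relation.Binary.Core using (Rel)
open import Relation.Binary.Definitions using (Decidable; Symmetric)
open import Relation.Binary.PropositionalEquality
  using (_≡_; _≢_; refl; cong; subst; subst₂; trans; sym)
open import Relation.Nullary using (¬_; Dec; yes; no)
open import Relation.Nullary.Decidable using (dec-true; _×-dec_; _⊎-dec_)

open import Defs using (Graph; ℕ→ℚ; 2ℚ; NS; dS; _△_; W)

open import Algebra.Properties.CommutativeSemigroup
  (CommutativeRing.*-commutativeSemigroup +-*-commutativeRing) using (xy∙z≈xz∙y)

private
  variable
    ℓ : Level
    k n : ℕ

∣p∪q∣≤∣p∣+∣q∣ : (p q : Subset n) → ∣ p ∪ q ∣ ℕ.≤ ∣ p ∣ ℕ.+ ∣ q ∣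
∣p∪q∣≤∣p∣+∣q∣ [] [] = ℕ.z≤n
∣p∪q∣≤∣p∣+∣q∣ (inside ∷ p) (b ∷ q) =
  ℕ.s≤s (ℕ.≤-trans (∣p∪q∣≤∣p∣+∣q∣ p q) (ℕ.+-monoʳ-≤ ∣ p ∣ (∣p∣≤∣x∷p∣ b q)))
∣p∪q∣≤∣p∣+∣q∣ (outside ∷ p) (inside ∷ q) =
  ℕ.≤-trans (ℕ.s≤s (∣p∪q∣≤∣p∣+∣q∣ p q)) (ℕ.≤-reflexive (sym (ℕ.+-suc ∣ p ∣ ∣ q ∣)))
∣p∪q∣≤∣p∣+∣q∣ (outside ∷ p) (outside ∷ q) = ∣p∪q∣≤∣p∣+∣q∣ p q

△-comm : (p q : Subset n) → p △ q ≡ q △ p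
△-comm p q = ∪-comm (p ─ q) (q ─ p)

∣p△p∣≡0 : (p : Subset n) → ∣ p △ p ∣ ≡ 0
∣p△p∣≡0 [] = refl
∣p△p∣≡0 (inside ∷ p) = ∣p△p∣≡0 p
∣p△p∣≡0 (outside ∷ p) = ∣p△p∣≡0 p

⋃[_]_ : Subset n → (Fin n → Subset k) → Subset k
⋃[ [] ] W = ⊥
⋃[ inside ∷ U ] W = W zero ∪ ⋃[ U ] (W ∘ suc)
⋃[ outside ∷ U ] W = ⋃[ U ] (W ∘ suc)

⊆⋃[] : ∀ {U : Subset n} {u} (W : Fin n → Subset k) → u ∈ U → W u ⊆ ⋃[ U ] W
⊆⋃[] {U = inside ∷ U} W here = p⊆p∪q _
⊆⋃[] {U = inside ∷ U} W (there u∈U) = q⊆p∪q (W zero) _ ∘ ⊆⋃[] (W ∘ suc) u∈U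
⊆⋃[] {U = outside ∷ U} W (there u∈U) = ⊆⋃[] (W ∘ suc) u∈U

∣⋃[]∣≤ : ∀ (U : Subset n) (W : Fin n → Subset k) {b} →
         (∀ {u} → u ∈ U → ∣ W u ∣ ℕ.≤ b) → ∣ ⋃[ U ] W ∣ ℕ.≤ ∣ U ∣ ℕ.* b
∣⋃[]∣≤ {k = k} [] W _ = ℕ.≤-reflexive (∣⊥∣≡0 k)
∣⋃[]∣≤ (inside ∷ U) W {b} bound = begin
  ∣ W zero ∪ ⋃[ U ] (W ∘ suc) ∣       ≤⟨ ∣p∪q∣≤∣p∣+∣q∣ (W zero) _ ⟩
  ∣ W zero ∣ ℕ.+ ∣ ⋃[ U ] (W ∘ suc) ∣  ≤⟨ ℕ.+-mono-≤ (bound here) (∣⋃[]∣≤ U (W ∘ suc) (bound ∘ there)) ⟩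
  b ℕ.+ ∣ U ∣ ℕ.* b                  ∎
  where open ℕ.≤-Reasoning
∣⋃[]∣≤ (outside ∷ U) W bound = ∣⋃[]∣≤ U (W ∘ suc) (bound ∘ there)

Independent : Rel (Fin n) ℓ → Subset n → Set ℓ
Independent R U = ∀ {u v} → u ∈ U → v ∈ U → u ≢ v → ¬ R u v

-- Counting members of U as dominated allows R to be irreflexive, as the relation
-- distance < 4^t d / M is when d = 0.
Dominated : Rel (Fin n) ℓ → Subset n → Fin n → Set ℓ
Dominated R U a = ∃[ u ] u ∈ U × (a ≡ u ⊎ R a u)

record MaximalIndependentSubset (R : Rel (Fin n) ℓ) (A : Subset n) : Set ℓ where
  field
    members     : Subset n
    members⊆A   : members ⊆ A
    independent : Independent R members
    dominating  : ∀ {a} → a ∈ A → Dominated R members a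

dominated-mono : ∀ {R : Rel (Fin n) ℓ} {U V a} → U ⊆ V → Dominated R U a → Dominated R V a
dominated-mono U⊆V (u , u∈U , close) = u , U⊆V u∈U , close

dominated? : ∀ {R : Rel (Fin n) ℓ} → Decidable R → ∀ U a → Dec (Dominated R U a)
dominated? R? U a = any? (λ u → u ∈? U ×-dec (a ≟ u ⊎-dec R? a u))

independent-∪⁅⁆ : ∀ {R : Rel (Fin n) ℓ} {U a} → Symmetric R →
  Independent R U → ¬ Dominated R U a → Independent R (U ∪ ⁅ a ⁆)
independent-∪⁅⁆ {R = R} {U} {a} R-sym indep undominated {u} {v} u∈ v∈ =
  cases (x∈p∪q⁻ U ⁅ a ⁆ u∈) (x∈p∪q⁻ U ⁅ a ⁆ v∈)
  where
  cases : u ∈ U ⊎ u ∈ ⁅ a ⁆ → v ∈ U ⊎ v ∈ ⁅ a ⁆ → u ≢ v → ¬ R u v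
  cases (inj₁ u∈U) (inj₁ v∈U) = indep u∈U v∈U
  cases (inj₁ u∈U) (inj₂ v∈a) _ Ruv =
    undominated (u , u∈U , inj₂ (R-sym (subst (R u) (x∈⁅y⁆⇒x≡y a v∈a) Ruv)))
  cases (inj₂ u∈a) (inj₁ v∈U) _ Ruv =
    undominated (v , v∈U , inj₂ (subst (λ x → R x v) (x∈⁅y⁆⇒x≡y a u∈a) Ruv))
  cases (inj₂ u∈a) (inj₂ v∈a) u≢v _ = u≢v (trans (x∈⁅y⁆⇒x≡y a u∈a) (sym (x∈⁅y⁆⇒x≡y a v∈a)))

module _ {R : Rel (Fin n) ℓ} (R? : Decidable R) (R-sym : Symmetric R) where

  private
    greedy : ∀ A (L : List (Fin n)) →
      ∃[ U ] U ⊆ A × Independent R U × (∀ {a} → a ∈ₗ L → a ∈ A → Dominated R U a)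
    greedy A []ₗ = ⊥ , ⊥-elim ∘ ∉⊥ , (⊥-elim ∘ ∉⊥) , λ ()
    greedy A (a ∷ₗ L) with greedy A L
    ... | U , U⊆A , indep , dom with a ∈? A | dominated? R? U a
    ... | no a∉A | _ =
          U , U⊆A , indep , λ { (hereₗ refl) a∈A → ⊥-elim (a∉A a∈A) ; (thereₗ x∈L) → dom x∈L }
    ... | yes _ | yes a-dom =
          U , U⊆A , indep , λ { (hereₗ refl) _ → a-dom ; (thereₗ x∈L) → dom x∈L }
    ... | yes a∈A | no a-undom =
          U ∪ ⁅ a ⁆ , U∪a⊆A , independent-∪⁅⁆ R-sym indep a-undom ,
          λ { (hereₗ refl) _ → a , q⊆p∪q U ⁅ a ⁆ (x∈⁅x⁆ a) , inj₁ refl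
            ; (thereₗ x∈L) x∈A → dominated-mono {R = R} (p⊆p∪q ⁅ a ⁆) (dom x∈L x∈A) }
      where
      U∪a⊆A : U ∪ ⁅ a ⁆ ⊆ A
      U∪a⊆A x∈ with x∈p∪q⁻ U ⁅ a ⁆ x∈
      ... | inj₁ x∈U = U⊆A x∈U
      ... | inj₂ x∈a = subst (_∈ A) (sym (x∈⁅y⁆⇒x≡y a x∈a)) a∈A

  maximalIndependentSubset : (A : Subset n) → MaximalIndependentSubset R A
  maximalIndependentSubset A with greedy A (allFin n)
  ... | U , U⊆A , indep , dom = record
    { members = U ; members⊆A = U⊆A ; independent = indep ; dominating = dom (∈-allFin _) }

dominated⇒⊆⋃[] : ∀ {R : Rel (Fin n) ℓ} {U A} (W : Fin n → Subset n) →
  (∀ {a} → a ∈ A → Dominated R U a) → (∀ {u} → u ∈ U → u ∈ W u) →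
  (∀ {a u} → u ∈ U → R a u → a ∈ W u) → A ⊆ ⋃[ U ] W
dominated⇒⊆⋃[] W dominated u∈W[u] near⇒∈W a∈A with dominated a∈A
... | u , u∈U , inj₁ refl = ⊆⋃[] W u∈U (u∈W[u] u∈U)
... | u , u∈U , inj₂ Rau = ⊆⋃[] W u∈U (near⇒∈W u∈U Rau)

ℕ→ℚ≡mkℚ : ∀ k → ℕ→ℚ k ≡ mkℚ (+ k) 0 (coprime-sym (1-coprimeTo k))
ℕ→ℚ≡mkℚ k = normalize-coprime (coprime-sym (1-coprimeTo k))

ℕ→ℚ-nonNeg : ∀ k → NonNegative (ℕ→ℚ k)
ℕ→ℚ-nonNeg k = normalize-nonNeg k 1

ℕ→ℚ-mono-≤ : ∀ {j k} → j ℕ.≤ k → ℕ→ℚ j ≤ ℕ→ℚ k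
ℕ→ℚ-mono-≤ {j} {k} j≤k rewrite ℕ→ℚ≡mkℚ j | ℕ→ℚ≡mkℚ k =
  *≤* (subst₂ ℤ._≤_ (sym (ℤ.*-identityʳ (+ j))) (sym (ℤ.*-identityʳ (+ k))) (ℤ.+≤+ j≤k))

ℕ→ℚ-homo-* : ∀ j k → ℕ→ℚ (j ℕ.* k) ≡ ℕ→ℚ j * ℕ→ℚ k
ℕ→ℚ-homo-* j k rewrite ℕ→ℚ≡mkℚ j | ℕ→ℚ≡mkℚ k = cong (_/ 1) (ℤ.pos-* j k)

+/≤+/⇒*≤* : ∀ {a b c d} .{{_ : ℕ.NonZero b}} .{{_ : ℕ.NonZero d}} →
            (+ a) / b ≤ (+ c) / d → a ℕ.* d ℕ.≤ c ℕ.* b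
+/≤+/⇒*≤* {a} {suc b} {c} {suc d} a/b≤c/d
  with ℚᵘ.*≤* ad≤cb ← ℚᵘ.≤-respʳ-≃ (toℚᵘ-fromℚᵘ (ℚᵘ.mkℚᵘ (+ c) d))
                        (ℚᵘ.≤-respˡ-≃ (toℚᵘ-fromℚᵘ (ℚᵘ.mkℚᵘ (+ a) b)) (toℚᵘ-mono-≤ a/b≤c/d)) =
  ℤ.drop‿+≤+ (subst₂ ℤ._≤_ (sym (ℤ.pos-* a (suc d))) (sym (ℤ.pos-* c (suc b))) ad≤cb)

ℕ→ℚ≤+/⇒≤/ : ∀ {a c d} .{{_ : ℕ.NonZero d}} → ℕ→ℚ a ≤ (+ c) / d → a ℕ.≤ c ℕ./ d
ℕ→ℚ≤+/⇒≤/ {a} {c} {d} a≤c/d = begin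
  a               ≡⟨ ℕ.m*n/n≡m a d ⟨
  a ℕ.* d ℕ./ d   ≤⟨ ℕ./-monoˡ-≤ d (ℕ.≤-trans (+/≤+/⇒*≤* {a} {1} {c} {d} a≤c/d) (ℕ.≤-reflexive (ℕ.*-identityʳ c))) ⟩
  c ℕ./ d         ∎
  where open ℕ.≤-Reasoning

≤*/⇒*≤* : ∀ {a} b c d .{{_ : ℕ.NonZero d}} → a ℕ.≤ b ℕ.* (c ℕ./ d) → a ℕ.* d ℕ.≤ b ℕ.* c
≤*/⇒*≤* {a} b c d a≤b[c/d] = begin
  a ℕ.* d                ≤⟨ ℕ.*-monoˡ-≤ d a≤b[c/d] ⟩
  b ℕ.* (c ℕ./ d) ℕ.* d   ≡⟨ ℕ.*-assoc b (c ℕ./ d) d ⟩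
  b ℕ.* (c ℕ./ d ℕ.* d)   ≤⟨ ℕ.*-monoʳ-≤ b (ℕ.m/n*n≤m c d) ⟩
  b ℕ.* c                ∎
  where open ℕ.≤-Reasoning

p*n≤m∧m*m≤k*n⇒p*m≤k : ∀ p m k n .{{_ : ℕ.NonZero n}} →
  p * ℕ→ℚ n ≤ ℕ→ℚ m → m ℕ.* m ℕ.≤ k ℕ.* n → p * ℕ→ℚ m ≤ ℕ→ℚ k
p*n≤m∧m*m≤k*n⇒p*m≤k p m k n pn≤m mm≤kn =
  *-cancelʳ-≤-pos (ℕ→ℚ n) {{normalize-pos n 1}} (begin
    p * ℕ→ℚ m * ℕ→ℚ n    ≡⟨ xy∙z≈xz∙y p (ℕ→ℚ m) (ℕ→ℚ n) ⟩
    p * ℕ→ℚ n * ℕ→ℚ m    ≤⟨ *-monoʳ-≤-nonNeg (ℕ→ℚ m) {{ℕ→ℚ-nonNeg m}} pn≤m ⟩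
    ℕ→ℚ m * ℕ→ℚ m        ≡⟨ ℕ→ℚ-homo-* m m ⟨
    ℕ→ℚ (m ℕ.* m)        ≤⟨ ℕ→ℚ-mono-≤ mm≤kn ⟩
    ℕ→ℚ (k ℕ.* n)        ≡⟨ ℕ→ℚ-homo-* k n ⟩
    ℕ→ℚ k * ℕ→ℚ n        ∎)
  where open ≤-Reasoning

p÷2≤p : ∀ p .{{_ : NonNegative p}} → p ÷ 2ℚ ≤ p
p÷2≤p p = subst₂ _≤_ refl (*-identityʳ p) (*-monoˡ-≤-nonNeg p (*≤* (ℤ.+≤+ (ℕ.s≤s ℕ.z≤n))))

module ClusterNeighbourhood {n} (G : Graph n) (S : Subset n) (t : ℕ)
         (M : ℚ) .{{_ : Positive M}} where

  private instance
    M-nonZero : NonZero M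
    M-nonZero = pos⇒nonZero M
    1/M-nonNeg : NonNegative (1/ M)
    1/M-nonNeg = pos⇒nonNeg (1/ M) {{1/pos⇒pos M}}
    4^t÷M-nonNeg : NonNegative (ℕ→ℚ (4 ^ t) ÷ M)
    4^t÷M-nonNeg = nonNeg*nonNeg⇒nonNeg (ℕ→ℚ (4 ^ t)) {{ℕ→ℚ-nonNeg (4 ^ t)}} (1/ M)

  distance : Fin n → Fin n → ℕ
  distance u v = ∣ NS G S u △ NS G S v ∣

  distance-sym : ∀ u v → distance u v ≡ distance v u
  distance-sym u v = cong ∣_∣ (△-comm (NS G S u) (NS G S v))

  Near : ℚ → Rel (Fin n) 0ℓ
  Near r u v = ℕ→ℚ (distance u v) < r

  near? : ∀ r → Decidable (Near r)
  near? r u v = ℕ→ℚ (distance u v) <? r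

  near-sym : ∀ {r} → Symmetric (Near r)
  near-sym {r} {u} {v} = subst (λ k → ℕ→ℚ k < r) (distance-sym u v)

  radius : Fin n → ℚ
  radius v = (ℕ→ℚ (4 ^ t) ÷ M) * ℕ→ℚ (dS G S v)

  ∈W : ∀ {u v} → ℕ→ℚ (distance u v) ≤ radius v → u ∈ W G S t M v
  ∈W {u} {v} u-near = lookup⇒[]= u (W G S t M v) (trans (lookup∘tabulate _ u) (dec-true (_ ≤? _) u-near))

  ∈W-self : ∀ v → v ∈ W G S t M v
  ∈W-self v = ∈W (subst (λ k → ℕ→ℚ k ≤ radius v) (sym (∣p△p∣≡0 (NS G S v)))
                  (nonNegative⁻¹ (radius v)
                    {{nonNeg*nonNeg⇒nonNeg (ℕ→ℚ (4 ^ t) ÷ M) (ℕ→ℚ (dS G S v)) {{ℕ→ℚ-nonNeg (dS G S v)}}}}))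

  ∈W-near : ∀ {d u v} → d ≤ ℕ→ℚ (dS G S v) →
            Near ((ℕ→ℚ (4 ^ t) * d) ÷ M) u v → u ∈ W G S t M v
  ∈W-near {d} {u} {v} d≤dS u-near = ∈W (<⇒≤ (<-≤-trans u-near (begin
    ℕ→ℚ (4 ^ t) * d * 1/ M    ≡⟨ xy∙z≈xz∙y (ℕ→ℚ (4 ^ t)) d (1/ M) ⟩
    ℕ→ℚ (4 ^ t) ÷ M * d       ≤⟨ *-monoˡ-≤-nonNeg (ℕ→ℚ (4 ^ t) ÷ M) d≤dS ⟩
    radius v                  ∎)))
    where open ≤-Reasoning

lemma4p6 : ∀ {n : ℕ} (G : Graph n) (S : Subset n) (M : ℚ) .{{_ : NonZero M}}
    (t : ℕ) (d δ : ℚ) → 1ℚ < M → 0ℚ ≤ d → 0ℚ < δ →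
    (A : Subset n) .{{_ : ℕ.NonZero ∣ A ∣}} →
    δ * ℕ→ℚ n ≤ ℕ→ℚ ∣ A ∣ → 1ℚ ≤ δ * ℕ→ℚ n →
    (∀ v → v ∈ A → ℕ→ℚ ∣ W G S t M v ∣ ≤ (+ n) / ∣ A ∣) →
    (∀ v → v ∈ A → d ≤ ℕ→ℚ (dS G S v)) →
    Σ (Subset n) (λ U → U ⊆ A × (δ * ℕ→ℚ ∣ A ∣) ÷ 2ℚ ≤ ℕ→ℚ ∣ U ∣ ×
      (∀ u v → u ∈ U → v ∈ U → u ≢ v →
        (ℕ→ℚ (4 ^ t) * d) ÷ M ≤ ℕ→ℚ ∣ NS G S u △ NS G S v ∣))
lemma4p6 {n} G S M t d δ 1<M _ 0<δ A δn≤∣A∣ _ W-small degree-large =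
  U , U⊆A , ≤-trans (p÷2≤p (δ * ℕ→ℚ ∣ A ∣) {{δ∣A∣-nonNeg}}) δ∣A∣≤∣U∣ ,
  λ u v u∈U v∈U u≢v → ≮⇒≥ (independent u∈U v∈U u≢v)
  where
  instance
    M-pos : Positive M
    M-pos = positive (<-trans (positive⁻¹ 1ℚ) 1<M)
    n-nonZero : ℕ.NonZero n
    n-nonZero = ℕ.>-nonZero (ℕ.<-≤-trans (ℕ.>-nonZero⁻¹ ∣ A ∣) (∣p∣≤n A))

  δ∣A∣-nonNeg : NonNegative (δ * ℕ→ℚ ∣ A ∣)
  δ∣A∣-nonNeg = nonNeg*nonNeg⇒nonNeg δ {{pos⇒nonNeg δ {{positive 0<δ}}}} (ℕ→ℚ ∣ A ∣) {{ℕ→ℚ-nonNeg ∣ A ∣}}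

  open ClusterNeighbourhood G S t M
  open MaximalIndependentSubset (maximalIndependentSubset (near? ((ℕ→ℚ (4 ^ t) * d) ÷ M)) near-sym A)
    renaming (members to U; members⊆A to U⊆A)

  A⊆⋃W : A ⊆ ⋃[ U ] W G S t M
  A⊆⋃W = dominated⇒⊆⋃[] (W G S t M) dominating (λ _ → ∈W-self _)
           (λ u∈U → ∈W-near (degree-large _ (U⊆A u∈U)))

  ∣A∣≤∣U∣⌊n/∣A∣⌋ : ∣ A ∣ ℕ.≤ ∣ U ∣ ℕ.* (n ℕ./ ∣ A ∣)
  ∣A∣≤∣U∣⌊n/∣A∣⌋ = ℕ.≤-trans (p⊆q⇒∣p∣≤∣q∣ A⊆⋃W)
    (∣⋃[]∣≤ U (W G S t M) (λ u∈U → ℕ→ℚ≤+/⇒≤/ {c = n} (W-small _ (U⊆A u∈U))))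

  δ∣A∣≤∣U∣ : δ * ℕ→ℚ ∣ A ∣ ≤ ℕ→ℚ ∣ U ∣
  δ∣A∣≤∣U∣ = p*n≤m∧m*m≤k*n⇒p*m≤k δ ∣ A ∣ ∣ U ∣ n δn≤∣A∣ (≤*/⇒*≤* (∣ U ∣) n (∣ A ∣) ∣A∣≤∣U∣⌊n/∣A∣⌋)
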